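{- If $(\mathcal{C},\mathcal{K})$ is a connective island domain on the finite set $U$ and $\mathcal{S}$ is a system of pre-islands corresponding to $(\mathcal{C},\mathcal{K})$, then $|\mathcal{S}|\leq|U|$.
   Context: An island domain is a pair $(\mathcal{C},\mathcal{K})$ where $U$ is a nonempty finite set and $\mathcal{C}\subseteq\mathcal{K}\subseteq\mathcal{P}(U)$ with $U\in\mathcal{C}$. It is connective if for all $A,B\in\mathcal{C}$ with $A\cap B\neq\emptyset$ and $B\not\subseteq A$ there exists $K\in\mathcal{K}$ with $A\subsetneq K\subseteq A\cup B$. A height function is any map $h\colon U\to\mathbb{R}$. Let $\prec$ denote the cover relation of the poset $(\mathcal{K},\subseteq)$. For a nonempty $S\in\mathcal{C}$, $S$ is a pre-island with respect to $(\mathcal{C},\mathcal{K},h)$ if every $K\in\mathcal{K}$ with $S\prec K$ satisfies $\min h(K)<\min h(S)$. A system of pre-islands corresponding to $(\mathcal{C},\mathcal{K})$ is a family that equals, for some height function $h$, the set of all nonempty $S\in\mathcal{C}$ that are pre-islands with respect to $(\mathcal{C},\mathcal{K},h)$. -}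

module Defs where

open import Level using (Level; 0ℓ)
open import Data.Nat using (ℕ; suc)
open import Data.Fin using (Fin)
open import Data.Fin.Subset using (Subset; _∈_; _⊆_; _⊂_; _∩_; _∪_; ⊤; Nonempty)
open import Data.Product using (_×_; ∃)
open import Relation.Nullary using (¬_)
open import Relation.Binary.Bundles using (StrictTotalOrder)

-- The ground set U is Fin n (nonempty means n = suc m, imposed in the theorem).
-- A family of subsets of U is a predicate on Subset n (U is finite, so every such family is finite).
Family : ℕ → Set₁
Family n = Subset n → Set

record IslandDomain {n : ℕ} (C K : Family n) : Set where
  field
    C⊆K  : ∀ A → C A → K A
    U∈C  : C ⊤

Connective : {n : ℕ} → Family n → Family n → Set
Connective {n} C K =
  ∀ (A B : Subset n) → C A → C B → Nonempty (A ∩ B) → ¬ (B ⊆ A) →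
  ∃ λ (L : Subset n) → K L × A ⊂ L × L ⊆ A ∪ B

Covers : {n : ℕ} → Family n → Subset n → Subset n → Set
Covers {n} K S L =
  K S × K L × S ⊂ L × (∀ (M : Subset n) → K M → S ⊂ M → ¬ (M ⊂ L))

module _ {a ℓ₁ ℓ₂ : Level} (O : StrictTotalOrder a ℓ₁ ℓ₂) where
  open StrictTotalOrder O renaming (Carrier to H)

  -- min h(L) < min h(S), for nonempty L, S (literally: some value of h on L
  -- lies strictly below every value of h on S).
  MinLt : {n : ℕ} → (Fin n → H) → Subset n → Subset n → Set ℓ₂
  MinLt h L S = ∃ λ x → x ∈ L × (∀ y → y ∈ S → h x < h y)

  PreIsland : {n : ℕ} → Family n → Family n → (Fin n → H) → Subset n → Set ℓ₂
  PreIsland {n} C K h S =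
    Nonempty S × C S × (∀ (L : Subset n) → K L → Covers K S L → MinLt h L S)

module Submission where

-- Send every pre-island S to a point
-- x ∈ S at which h attains its minimum on S.  This map is injective on a
-- system of pre-islands: if distinct pre-islands S, T shared a minimum point
-- x, then, say, T ⊈ S and connectivity yields L ∈ K with S ⊂ L ⊆ S ∪ T.
-- Below L there is a cover L' of S, and since S is a pre-island some z ∈ L'
-- has h z < min h(S) = h x; but z ∈ S ∪ T and x minimises h on S and on T.

open import Defs
open import Level using (Level)
open import Data.Nat using (ℕ; suc; _≤_)
open import Data.Fin using (Fin)
open import Data.Fin.Subset using (Subset)
open import Data.List using (List; length)
open import Data.List.Relation.Unary.All using (All)
open import Data.List.Relation.Unary.Unique.Propositional using (Unique)
open import Relation.Binary.Bundles using (StrictTotalOrder)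

open import Data.Fin using (zero; suc)
open import Data.Fin.Properties using (injective⇒≤)
open import Data.Fin.Subset using (_∈_; _⊆_; _⊂_; Nonempty)
open import Data.Fin.Subset.Properties
  using (_∈?_; _⊆?_; ⊆-refl; ⊆-trans; ⊆-antisym; p⊂q⇒p⊆q; x∈p∪q⁻; x∈p∩q⁺)
open import Data.Fin.Subset.Induction using (Acc; acc; ⊂-wellFounded)
open import Data.List using (allFin; filter; lookup)
open import Data.List.Membership.Propositional.Properties using (∈-allFin; ∈-filter⁺; ∈-lookup)
import Data.List.Relation.Unary.All as All
open import Data.List.Relation.Unary.All.Properties using (all-filter)
open import Data.List.Relation.Unary.AllPairs using (_∷_)
open import Data.Product using (_×_; _,_; proj₁; proj₂; ∃)
open import Data.Sum using (inj₁; inj₂)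
open import Data.Empty using (⊥-elim)
open import Function using (Injective)
open import Relation.Nullary using (¬_)
open import Relation.Nullary.Decidable using (decidable-stable)
open import Relation.Binary.PropositionalEquality using (_≡_; refl; sym; cong; subst)
import Data.List.Extrema

lookup-injective : ∀ {a} {A : Set a} {xs : List A} → Unique xs →
                   ∀ i j → lookup xs i ≡ lookup xs j → i ≡ j
lookup-injective (_ ∷ _)       zero    zero    _  = refl
lookup-injective (x∉xs ∷ _)    zero    (suc j) eq = ⊥-elim (All.lookup x∉xs (∈-lookup j) eq)
lookup-injective (x∉xs ∷ _)    (suc i) zero    eq = ⊥-elim (All.lookup x∉xs (∈-lookup i) (sym eq))
lookup-injective (_ ∷ unique)  (suc i) (suc j) eq = cong suc (lookup-injective unique i j eq)

-- Every proper K-superset L of S ∈ K lies above some cover of S in (K, ⊆).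
-- Membership in K is not decidable, so the statement is negative: it refutes
-- that all covers of S escape L.  Well-founded induction on L under ⊂: either
-- L itself covers S, or some M ∈ K with S ⊂ M ⊂ L takes its place.
cover-below : ∀ {n} (K : Family n) {S L : Subset n} → K S → K L → S ⊂ L →
              ¬ (∀ L′ → Covers K S L′ → ¬ (L′ ⊆ L))
cover-below K {S} {L} kS kL S⊂L = below (⊂-wellFounded L) kL S⊂L
  where
    below : ∀ {L} → Acc _⊂_ L → K L → S ⊂ L → ¬ (∀ L′ → Covers K S L′ → ¬ (L′ ⊆ L))
    below {L} (acc smaller) kL S⊂L escapes = no-intermediate intermediate
      where
        Intermediate : Set
        Intermediate = ∃ λ M → K M × S ⊂ M × M ⊂ L

        intermediate : ¬ Intermediate
        intermediate (M , kM , S⊂M , M⊂L) =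
          below (smaller M⊂L) kM S⊂M
            λ L′ cov L′⊆M → escapes L′ cov (⊆-trans L′⊆M (p⊂q⇒p⊆q M⊂L))

        no-intermediate : ¬ ¬ Intermediate
        no-intermediate none =
          escapes L (kS , kL , S⊂L , λ M kM S⊂M M⊂L → none (M , kM , S⊂M , M⊂L)) ⊆-refl

module _ {a ℓ₁ ℓ₂ : Level} (O : StrictTotalOrder a ℓ₁ ℓ₂) where
  open StrictTotalOrder O renaming (Carrier to H)
  open import Relation.Binary.Properties.StrictTotalOrder O using (totalOrder)
  open Data.List.Extrema totalOrder using (argmin; argmin-all; f[argmin]≤f[xs])

  MinimumPoint : ∀ {n} → (Fin n → H) → Subset n → Fin n → Set ℓ₂
  MinimumPoint h p x = x ∈ p × (∀ y → y ∈ p → ¬ (h y < h x))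

  minimum-point : ∀ {n} (h : Fin n → H) (p : Subset n) → Nonempty p → ∃ (MinimumPoint h p)
  minimum-point {n} h p (x₀ , x₀∈p) = m , m∈p , minimal
    where
      elements : List (Fin n)
      elements = filter (_∈? p) (allFin n)

      m : Fin n
      m = argmin h x₀ elements

      m∈p : m ∈ p
      m∈p = argmin-all h x₀∈p (all-filter (_∈? p) (allFin n))

      minimal : ∀ y → y ∈ p → ¬ (h y < h m)
      minimal y y∈p y<m with All.lookup (f[argmin]≤f[xs] x₀ elements) (∈-filter⁺ (_∈? p) (∈-allFin y) y∈p)
      ... | inj₁ m<y = asym m<y y<m
      ... | inj₂ m≈y = irrefl (Eq.sym m≈y) y<m

  module _ {n : ℕ} {C K : Family n} (D : IslandDomain C K) (connective : Connective C K)
           (h : Fin n → H) where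

    shared-minimum⇒⊆ : ∀ {S T x} → PreIsland O C K h S → C T →
                       MinimumPoint h S x → MinimumPoint h T x → ¬ ¬ (T ⊆ S)
    shared-minimum⇒⊆ {S} {T} {x} (_ , cS , coverLower) cT (x∈S , minS) (x∈T , minT) T⊈S
      with connective S T cS cT (x , x∈p∩q⁺ (x∈S , x∈T)) T⊈S
    ... | L , kL , S⊂L , L⊆S∪T =
      cover-below K (IslandDomain.C⊆K D S cS) kL S⊂L
        λ L′ cov L′⊆L → below-x (coverLower L′ (proj₁ (proj₂ cov)) cov) L′⊆L
      where
        below-x : ∀ {L′} → MinLt O h L′ S → ¬ (L′ ⊆ L)
        below-x (z , z∈L′ , z<S) L′⊆L with x∈p∪q⁻ S T (L⊆S∪T (L′⊆L z∈L′))
        ... | inj₁ z∈S = minS z z∈S (z<S x x∈S)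
        ... | inj₂ z∈T = minT z z∈T (z<S x x∈S)

    shared-minimum⇒≡ : ∀ {S T x} → PreIsland O C K h S → PreIsland O C K h T →
                       MinimumPoint h S x → MinimumPoint h T x → S ≡ T
    shared-minimum⇒≡ {S} {T} preS preT minS minT = ⊆-antisym S⊆T T⊆S
      where
        S⊆T : S ⊆ T
        S⊆T = decidable-stable (S ⊆? T) (shared-minimum⇒⊆ preT (proj₁ (proj₂ preS)) minT minS)
        T⊆S : T ⊆ S
        T⊆S = decidable-stable (T ⊆? S) (shared-minimum⇒⊆ preS (proj₁ (proj₂ preT)) minS minT)

theorem4p10 : ∀ {a ℓ₁ ℓ₂ : Level} (O : StrictTotalOrder a ℓ₁ ℓ₂) (m : ℕ)
    (C K : Family (suc m)) → IslandDomain C K → Connective C K →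
    (h : Fin (suc m) → StrictTotalOrder.Carrier O) →
    (Ss : List (Subset (suc m))) → Unique Ss → All (PreIsland O C K h) Ss →
    length Ss ≤ suc m
theorem4p10 O m C K D connective h Ss unique preIslands = injective⇒≤ point-injective
  where
    pre-island : ∀ i → PreIsland O C K h (lookup Ss i)
    pre-island i = All.lookup preIslands (∈-lookup i)

    minimum : ∀ i → ∃ (MinimumPoint O h (lookup Ss i))
    minimum i = minimum-point O h (lookup Ss i) (proj₁ (pre-island i))

    point : Fin (length Ss) → Fin (suc m)
    point i = proj₁ (minimum i)

    point-injective : Injective _≡_ _≡_ point
    point-injective {i} {j} same-point =
      lookup-injective unique i j
        (shared-minimum⇒≡ O D connective h (pre-island i) (pre-island j)
          (proj₂ (minimum i)) (subst (MinimumPoint O h (lookup Ss j)) (sym same-point) (proj₂ (minimum j))))
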